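{- Let $\Gamma$ be a finite set and let $I\subset\Gamma\times\Gamma\times\Gamma$ be a NOF permutation problem. Then the adjacency tensor of the communication hypergraph $H(I)$ is a permutation of the matrix multiplication tensor $\langle |\Gamma|,|\Gamma|,|\Gamma|\rangle$, i.e. there are bijections $\phi_1,\phi_2,\phi_3: I\to\Gamma\times\Gamma$ mapping the support of the adjacency tensor of $H(I)$ (along the three axes) bijectively onto the support of $\langle |\Gamma|,|\Gamma|,|\Gamma|\rangle$. Moreover, under these bijections, the set $\tilde I=\{((x,y),(y,z),(z,x)) : (x,y,z)\in I\}$ of terms of the matrix multiplication tensor corresponds exactly to the set of diagonal terms $\{(t,t,t): t\in I\}$ of the adjacency tensor of $H(I)$.
   Context: A NOF permutation problem over $\Gamma$ is a set $I\subset\Gamma^3$ such that for any two coordinates of a triple, there is exactly one value of the remaining coordinate giving a triple in $I$ (equivalently, $I$ is a Latin square). The matrix multiplication tensor is $\langle n,m,p\rangle=\sum_{i\in[n],j\in[m],k\in[p]} x_{i,j}y_{j,k}z_{k,i}$; with $N=|\Gamma|$, $\langle N,N,N\rangle$ has index set $\Gamma^2$ on each axis and support $\{((i,j),(j,k),(k,i))\}$. The communication hypergraph $H(I)$ has vertex set $I$; for every $(x,y,z)\in\Gamma^3$ let $T_1=(x,y,z')$ be the unique triple of $I$ agreeing with $(x,y,z)$ in the first two coordinates, $T_2=(x',y,z)$ the unique triple of $I$ agreeing in the last two, and $T_3=(x,y',z)$ the unique triple of $I$ agreeing in the first and third; the hyperedges of $H(I)$ are all such ordered triples $(T_1,T_2,T_3)$.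 Its adjacency tensor is the $\{0,1\}$-valued tensor with index set $I$ on each axis whose support is the set of hyperedges (this includes $(t,t,t)$ for each $t\in I$). -}

module Defs where

open import Data.Bool using (Bool; T)
open import Data.Product using (Σ; ∃; ∃-syntax; _×_; _,_; proj₁; ∃!)
open import Relation.Binary.PropositionalEquality using (_≡_)

Triple : Set → Set
Triple Γ = Γ × Γ × Γ

-- A subset I ⊆ Γ³, given by a Boolean characteristic function
-- (so that membership proofs are proof-irrelevant).
Subset³ : Set → Set
Subset³ Γ = Triple Γ → Bool

Elt : {Γ : Set} → Subset³ Γ → Set
Elt {Γ} I = Σ (Triple Γ) (λ t → T (I t))

IsNOFPermutation : {Γ : Set} → Subset³ Γ → Set
IsNOFPermutation {Γ} I =
  (∀ (x y : Γ) → ∃! _≡_ (λ z → T (I (x , y , z)))) ×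
  (∀ (y z : Γ) → ∃! _≡_ (λ x → T (I (x , y , z)))) ×
  (∀ (x z : Γ) → ∃! _≡_ (λ y → T (I (x , y , z))))

-- This is the support of the adjacency tensor of H(I).
HEdge : {Γ : Set} (I : Subset³ Γ) → Elt I → Elt I → Elt I → Set
HEdge {Γ} I (t₁ , _) (t₂ , _) (t₃ , _) =
  Σ Γ λ x → Σ Γ λ y → Σ Γ λ z →
    (Σ Γ λ z' → t₁ ≡ (x , y , z')) ×
    (Σ Γ λ x' → t₂ ≡ (x' , y , z)) ×
    (Σ Γ λ y' → t₃ ≡ (x , y' , z))

-- Support of the matrix multiplication tensor ⟨N,N,N⟩ with index set Γ²
-- on each axis: { ((i , j) , (j , k) , (k , i)) }.
MMSupp : {Γ : Set} → Γ × Γ → Γ × Γ → Γ × Γ → Set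
MMSupp {Γ} a b c =
  Σ Γ λ i → Σ Γ λ j → Σ Γ λ k → a ≡ (i , j) × b ≡ (j , k) × c ≡ (k , i)

ITilde : {Γ : Set} (I : Subset³ Γ) → Γ × Γ → Γ × Γ → Γ × Γ → Set
ITilde {Γ} I a b c =
  Σ Γ λ x → Σ Γ λ y → Σ Γ λ z → T (I (x , y , z)) ×
    a ≡ (x , y) × b ≡ (y , z) × c ≡ (z , x)

-- Since any two coordinates of a triple of I determine the third, the projections
-- (x , y , z) ↦ (x , y), (y , z), (z , x) are bijections I ≅ Γ². A hyperedge based at
-- (x , y , z) ∈ Γ³ consists of triples whose projections are exactly (x , y), (y , z) and
-- (z , x), i.e. it is sent to a term of ⟨N,N,N⟩, and every such term arises this way.
-- A diagonal hyperedge (t , t , t) is sent to the term of Ĩ given by t; conversely, if the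
-- projections of a , b , c form the term of Ĩ given by t, injectivity forces a = b = c = t.
module Submission where

open import Defs
open import Data.Nat using (ℕ)
open import Data.Fin using (Fin)
open import Data.Bool using (T)
open import Data.Bool.Properties using (T-irrelevant)
open import Data.Product using (Σ; ∃!; _×_; _,_; proj₁; proj₂)
open import Function.Bundles using (_↔_; _⇔_; Inverse; Injection; mk↔ₛ′; mk⇔)
open import Function.Properties.Inverse using (↔⇒↣)
open import Relation.Binary.PropositionalEquality using (_≡_; refl; sym; trans; cong)

Elt-≡ : {Γ : Set} {I : Subset³ Γ} {a b : Elt I} → proj₁ a ≡ proj₁ b → a ≡ b
Elt-≡ {a = t , p} {b = .t , q} refl = cong (t ,_) (T-irrelevant p q)

xy yz zx : {Γ : Set} → Triple Γ → Γ × Γ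
xy (x , y , _) = x , y
yz (_ , y , z) = y , z
zx (x , _ , z) = z , x

Elt↔key : {Γ K : Set} (I : Subset³ Γ) (key : Triple Γ → K) (complete : K → Triple Γ) →
  (∀ k → key (complete k) ≡ k) →
  (∀ k → T (I (complete k))) →
  (∀ t → T (I t) → complete (key t) ≡ t) →
  Elt I ↔ K
Elt↔key I key complete key∘complete complete-∈ complete∘key =
  mk↔ₛ′ (λ a → key (proj₁ a)) (λ k → complete k , complete-∈ k)
    key∘complete (λ (t , p) → Elt-≡ (complete∘key t p))

HEdge⇒MMSupp : {Γ : Set} {I : Subset³ Γ} (a b c : Elt I) →
  HEdge I a b c → MMSupp (xy (proj₁ a)) (yz (proj₁ b)) (zx (proj₁ c))
HEdge⇒MMSupp (._ , _) (._ , _) (._ , _) (x , y , z , (_ , refl) , (_ , refl) , (_ , refl)) =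
  x , y , z , refl , refl , refl

MMSupp⇒HEdge : {Γ : Set} {I : Subset³ Γ} (a b c : Elt I) →
  MMSupp (xy (proj₁ a)) (yz (proj₁ b)) (zx (proj₁ c)) → HEdge I a b c
MMSupp⇒HEdge ((_ , _ , z') , _) ((x' , _ , _) , _) ((_ , y' , _) , _) (x , y , z , refl , refl , refl) =
  x , y , z , (z' , refl) , (x' , refl) , (y' , refl)

diagonal⇒ITilde : {Γ : Set} {I : Subset³ Γ} (a b c : Elt I) →
  a ≡ b × b ≡ c → ITilde I (xy (proj₁ a)) (yz (proj₁ b)) (zx (proj₁ c))
diagonal⇒ITilde ((x , y , z) , p) _ _ (refl , refl) = x , y , z , p , refl , refl , refl

module _ {Γ : Set} {I : Subset³ Γ} (nof : IsNOFPermutation I) where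

  private
    z-of : ∀ x y → ∃! _≡_ (λ z → T (I (x , y , z)))
    z-of = proj₁ nof
    x-of : ∀ y z → ∃! _≡_ (λ x → T (I (x , y , z)))
    x-of = proj₁ (proj₂ nof)
    y-of : ∀ x z → ∃! _≡_ (λ y → T (I (x , y , z)))
    y-of = proj₂ (proj₂ nof)

  xy↔ : Elt I ↔ (Γ × Γ)
  xy↔ = Elt↔key I xy (λ (x , y) → x , y , proj₁ (z-of x y)) (λ _ → refl)
    (λ (x , y) → proj₁ (proj₂ (z-of x y)))
    (λ (x , y , _) p → cong (λ z → x , y , z) (proj₂ (proj₂ (z-of x y)) p))

  yz↔ : Elt I ↔ (Γ × Γ)
  yz↔ = Elt↔key I yz (λ (y , z) → proj₁ (x-of y z) , y , z) (λ _ → refl)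
    (λ (y , z) → proj₁ (proj₂ (x-of y z)))
    (λ (_ , y , z) p → cong (λ x → x , y , z) (proj₂ (proj₂ (x-of y z)) p))

  zx↔ : Elt I ↔ (Γ × Γ)
  zx↔ = Elt↔key I zx (λ (z , x) → x , proj₁ (y-of x z) , z) (λ _ → refl)
    (λ (z , x) → proj₁ (proj₂ (y-of x z)))
    (λ (x , _ , z) p → cong (λ y → x , y , z) (proj₂ (proj₂ (y-of x z)) p))

  ITilde⇒diagonal : (a b c : Elt I) →
    ITilde I (xy (proj₁ a)) (yz (proj₁ b)) (zx (proj₁ c)) → a ≡ b × b ≡ c
  ITilde⇒diagonal a b c (x , y , z , p , a-xy , b-yz , c-zx) =
    trans a≡t (sym b≡t) , trans b≡t (sym c≡t)
    where
    t : Elt I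
    t = (x , y , z) , p
    a≡t : a ≡ t
    a≡t = Injection.injective (↔⇒↣ xy↔) {a} {t} a-xy
    b≡t : b ≡ t
    b≡t = Injection.injective (↔⇒↣ yz↔) {b} {t} b-yz
    c≡t : c ≡ t
    c≡t = Injection.injective (↔⇒↣ zx↔) {c} {t} c-zx

mainTheorem2 : (Γ : Set) (N : ℕ) → (Γ ↔ Fin N) →
    (I : Subset³ Γ) → IsNOFPermutation I →
    Σ (Elt I ↔ (Γ × Γ)) λ φ₁ → Σ (Elt I ↔ (Γ × Γ)) λ φ₂ → Σ (Elt I ↔ (Γ × Γ)) λ φ₃ →
      (∀ (a b c : Elt I) →
        HEdge I a b c ⇔ MMSupp (Inverse.to φ₁ a) (Inverse.to φ₂ b) (Inverse.to φ₃ c)) ×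
      (∀ (a b c : Elt I) →
        (a ≡ b × b ≡ c) ⇔ ITilde I (Inverse.to φ₁ a) (Inverse.to φ₂ b) (Inverse.to φ₃ c))
mainTheorem2 Γ N _ I nof =
  xy↔ nof , yz↔ nof , zx↔ nof ,
  (λ a b c → mk⇔ (HEdge⇒MMSupp a b c) (MMSupp⇒HEdge a b c)) ,
  (λ a b c → mk⇔ (diagonal⇒ITilde a b c) (ITilde⇒diagonal nof a b c))
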